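{- For every ecumenical formula of the form $A^c$ (with $A^i$ its intuitionistic counterpart) and every atomic system $S$, $\neg\neg A^i\Vdash^L_S A^c$.
   Context: Basic setting. Let $\mathsf{At}$ be a countably infinite set of atomic propositions and $\mathsf{At}_\bot=\mathsf{At}\cup\{\bot\}$. An atomic rule has the form "from premises $p_1,\dots,p_n$ ($n\ge 0$) infer $p$", with $p_j,p\in\mathsf{At}_\bot$, where the derivation of each premise may discharge a set of basic sentences. An atomic system $S$ is a set of atomic rules; $S\subseteq S'$ ($S'$ extends $S$) if $S'$ contains all rules of $S$. $\Delta\vdash_S p$ means there is a natural-deduction derivation using only rules of $S$ with conclusion $p$ and undischarged assumptions in $\Delta$ (so $p\vdash_S p$). $S$ is consistent if $\nvdash_S\bot$. Standing convention: all atomic systems (including all extensions quantified over) are required to be consistent. Ecumenical formulas: $p^i,p^c$ for $p\in\mathsf{At}_\bot$; $(A\wedge B)^x,(A\vee B)^x,(A\to B)^x$ for $x\in\{i,c\}$. $A\wedge B$, $A\vee B$, $A\to B$ abbreviate the $i$-versions, $\bot$ denotes $\bot^i$, $\neg A:=(A\to\bot^i)^i$; for $X^c$, $X^i$ is the same construction with outer superscript $i$. Weak validity (by simultaneous recursion): (1) $\Vdash^L_S p^i$ iff $\vdash_S p$ ($p\in\mathsf{At}_\bot$); (2) $\Vdash^L_S p^c$ iff $p\nvdash_S\bot$; (3) for non-atomic $X$, $\Vdash^L_S X^c$ iff $X^i\nVdash^L_S\bot$; (4) $\Vdash^L_S(A\wedge B)^i$ iff $\Vdash^L_S A$ and $\Vdash^L_S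 B$; (5) $\Vdash^L_S(A\to B)^i$ iff $A\Vdash^G_S B$; (6) $\Vdash^L_S(A\vee B)^i$ iff for all $S'\supseteq S$ and all $p\in\mathsf{At}_\bot$, if $A\Vdash^L_{S'}p^i$ and $B\Vdash^L_{S'}p^i$ then $\Vdash^L_{S'}p^i$; (7) for nonempty $\Gamma$, $\Gamma\Vdash^L_S A$ iff for all $S'\supseteq S$, if $\Vdash^L_{S'}B$ for all $B\in\Gamma$ then $\Vdash^L_{S'}A$; (8) $\Gamma\Vdash^G_S A$ iff for all $S'\supseteq S$: if $\Vdash^L_{S''}B$ for all $B\in\Gamma$ and all $S''\supseteq S'$, then $\Vdash^L_{S''}A$ for all $S''\supseteq S'$. -}

module Defs where

open import Level using (Level; Lift; lift; lower) renaming (zero to ℓ0; suc to lsuc)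
open import Data.Nat using (ℕ)
open import Data.List using (List; []; _∷_; _++_)
open import Data.List.Membership.Propositional using (_∈_)
open import Data.List.Relation.Unary.All using (All)
open import Data.Product using (_×_; _,_)
open import Data.Empty using (⊥)
open import Relation.Nullary using (¬_)

-- Atoms: At = ℕ (countably infinite); At⊥ = At ∪ {⊥}

data AtB : Set where
  atom : ℕ → AtB
  bot  : AtB

-- Atomic rules: premises (Γⱼ , pⱼ) where Γⱼ is the (finite) set of basic
-- sentences discharged in the derivation of premise pⱼ; conclusion p.

record Rule : Set where
  constructor rule
  field
    premises   : List (List AtB × AtB)
    conclusion : AtB

Sys : Set₁
Sys = Rule → Set

_⊆S_ : Sys → Sys → Set
S ⊆S S' = ∀ r → S r → S' r

mutual
  data Der (S : Sys) (Δ : List AtB) : AtB → Set where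
    assum : ∀ {p} → p ∈ Δ → Der S Δ p
    apply : ∀ (ps : List (List AtB × AtB)) (p : AtB) →
            S (rule ps p) → Prems S Δ ps → Der S Δ p

  data Prems (S : Sys) (Δ : List AtB) : List (List AtB × AtB) → Set where
    []  : Prems S Δ []
    _∷_ : ∀ {Γ q ps} → Der S (Γ ++ Δ) q → Prems S Δ ps → Prems S Δ ((Γ , q) ∷ ps)

Consistent : Sys → Set
Consistent S = ¬ Der S [] bot

-- Extensions quantified over are consistent (standing convention)
Ext : Sys → Sys → Set
Ext S S' = S ⊆S S' × Consistent S'

data Kind : Set where
  i c : Kind

data Conn : Set where
  and or imp : Conn

data Form : Set where
  at  : AtB → Kind → Form
  bin : Conn → Kind → Form → Form → Form

outer : Form → Kind
outer (at _ k)      = k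
outer (bin _ k _ _) = k

toI : Form → Form
toI (at p _)      = at p i
toI (bin o _ A B) = bin o i A B

⊥i : Form
⊥i = at bot i

neg : Form → Form
neg A = bin imp i A ⊥i

-- For the i-versions of compound formulas we use the auxiliary ⊩Li, with
--   ⊩L S (bin o i A B) = ⊩Li S o A B   (definitionally),
-- so that clause (3) can refer to X^i structurally.

mutual
  ⊩L : Sys → Form → Set₁
  ⊩L S (at p i)      = Lift (lsuc ℓ0) (Der S [] p)
  ⊩L S (at p c)      = Lift (lsuc ℓ0) (¬ Der S (p ∷ []) bot)
  ⊩L S (bin o i A B) = ⊩Li S o A B
  ⊩L S (bin o c A B) =
    ¬ (∀ S' → Ext S S' → ⊩Li S' o A B → ⊩L S' ⊥i)

  ⊩Li : Sys → Conn → Form → Form → Set₁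
  ⊩Li S and A B = ⊩L S A × ⊩L S B
  ⊩Li S imp A B =
    ∀ S' → Ext S S' →
      (∀ S'' → Ext S' S'' → ⊩L S'' A) →
      (∀ S'' → Ext S' S'' → ⊩L S'' B)
  ⊩Li S or A B =
    ∀ S' → Ext S S' → ∀ (p : AtB) →
      (∀ S'' → Ext S' S'' → ⊩L S'' A → ⊩L S'' (at p i)) →
      (∀ S'' → Ext S' S'' → ⊩L S'' B → ⊩L S'' (at p i)) →
      ⊩L S' (at p i)

_⊩[_]_ : Form → Sys → Form → Set₁
A ⊩[ S ] B = ∀ S' → Ext S S' → ⊩L S' A → ⊩L S' B

{-# OPTIONS --safe #-}
module Submission where

-- If p^c fails at S, i.e. p ⊢_S ⊥, then substituting derivations of p shows ¬p^i holds in
-- every extension of S; if X^c fails for compound X, then X^i ⊩ ⊥ directly gives ¬X^i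
-- everywhere above S. Either way ¬¬X^i turns this into a derivation of ⊥ in S itself,
-- contradicting consistency.

open import Defs
open import Relation.Binary.PropositionalEquality using (_≡_; refl)
open import Level using (lift; lower)
open import Data.List using ([]; _∷_; _++_)
open import Data.List.Membership.Propositional using (_∈_)
open import Data.List.Relation.Unary.Any using (here)
open import Data.List.Relation.Binary.Subset.Propositional using (_⊆_)
open import Data.List.Membership.Propositional.Properties using (∈-++⁻; ∈-++⁺ˡ; ∈-++⁺ʳ)
open import Data.List.Relation.Binary.Subset.Propositional.Properties using (++⁺ʳ)
open import Data.Product using (_,_; proj₁)
open import Data.Sum using (inj₁; inj₂)
open import Function using (_∘′_)
open import Relation.Nullary using (¬_)

mutual
  Der-weaken : ∀ {S Δ Δ' q} → Δ ⊆ Δ' → Der S Δ q → Der S Δ' q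
  Der-weaken Δ⊆Δ' (assum q∈Δ)          = assum (Δ⊆Δ' q∈Δ)
  Der-weaken Δ⊆Δ' (apply ps p r prems) = apply ps p r (Prems-weaken Δ⊆Δ' prems)

  Prems-weaken : ∀ {S Δ Δ' ps} → Δ ⊆ Δ' → Prems S Δ ps → Prems S Δ' ps
  Prems-weaken Δ⊆Δ' []                      = []
  Prems-weaken Δ⊆Δ' (_∷_ {Γ = Γ} d prems) =
    Der-weaken (++⁺ʳ Γ Δ⊆Δ') d ∷ Prems-weaken Δ⊆Δ' prems

mutual
  Der-subst : ∀ {S S' Δ Δ' q} → S ⊆S S' → (∀ {x} → x ∈ Δ → Der S' Δ' x) →
              Der S Δ q → Der S' Δ' q
  Der-subst S⊆S' σ (assum q∈Δ)          = σ q∈Δ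
  Der-subst S⊆S' σ (apply ps p r prems) = apply ps p (S⊆S' _ r) (Prems-subst S⊆S' σ prems)

  Prems-subst : ∀ {S S' Δ Δ' ps} → S ⊆S S' → (∀ {x} → x ∈ Δ → Der S' Δ' x) →
                Prems S Δ ps → Prems S' Δ' ps
  Prems-subst S⊆S' σ [] = []
  Prems-subst {Δ' = Δ'} S⊆S' σ (_∷_ {Γ = Γ} d prems) =
    Der-subst S⊆S' σ-under-Γ d ∷ Prems-subst S⊆S' σ prems
    where
    σ-under-Γ : ∀ {x} → x ∈ Γ ++ _ → Der _ (Γ ++ Δ') x
    σ-under-Γ x∈ with ∈-++⁻ Γ x∈
    ... | inj₁ x∈Γ = assum (∈-++⁺ˡ x∈Γ)
    ... | inj₂ x∈Δ = Der-weaken (∈-++⁺ʳ Γ) (σ x∈Δ)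

Ext-refl : ∀ {S} → Consistent S → Ext S S
Ext-refl con = (λ _ r → r) , con

Ext-trans : ∀ {S₁ S₂ S₃} → Ext S₁ S₂ → Ext S₂ S₃ → Ext S₁ S₃
Ext-trans (S₁⊆S₂ , _) (S₂⊆S₃ , con₃) = (λ r → S₂⊆S₃ r ∘′ S₁⊆S₂ r) , con₃

⊩-mono : ∀ {S S' X Y} → Ext S S' → X ⊩[ S ] Y → X ⊩[ S' ] Y
⊩-mono e X⊩Y S'' e' = X⊩Y S'' (Ext-trans e e')

⊩⊥i-inconsistent : ∀ {S} → Consistent S → ¬ ⊩L S ⊥i
⊩⊥i-inconsistent con ⊩⊥ = con (lower ⊩⊥)

refutable-atom : ∀ {S p} → Der S (p ∷ []) bot → at p i ⊩[ S ] ⊥i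
refutable-atom p⊢⊥ S' e ⊩p = lift (Der-subst (proj₁ e) (λ { (here refl) → lower ⊩p }) p⊢⊥)

⊩neg-of-refutable : ∀ {S X} → X ⊩[ S ] ⊥i → ⊩L S (neg X)
⊩neg-of-refutable X⊩⊥ S' e ⊩X S'' e' = X⊩⊥ S'' (Ext-trans e e') (⊩X S'' e')

¬⊩¬¬-of-refutable : ∀ {S X} → Consistent S → X ⊩[ S ] ⊥i → ¬ ⊩L S (neg (neg X))
¬⊩¬¬-of-refutable {X = X} con X⊩⊥ ⊩¬¬X =
  ⊩⊥i-inconsistent con (⊩¬¬X _ (Ext-refl con) ⊩¬X _ (Ext-refl con))
  where
  ⊩¬X : ∀ S' → Ext _ S' → ⊩L S' (neg X)
  ⊩¬X S' e = ⊩neg-of-refutable {X = X} (⊩-mono {X = X} {Y = ⊥i} e X⊩⊥)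

theorem7 : ∀ (S : Sys) → Consistent S → ∀ (A : Form) → outer A ≡ c →
    neg (neg (toI A)) ⊩[ S ] A
theorem7 S _ (at p .c) refl S' (_ , con') ⊩¬¬A =
  lift λ p⊢⊥ → ¬⊩¬¬-of-refutable {X = at p i} con' (refutable-atom {p = p} p⊢⊥) ⊩¬¬A
theorem7 S _ (bin o .c B C) refl S' (_ , con') ⊩¬¬A Aᵢ⊩⊥ =
  ¬⊩¬¬-of-refutable {X = bin o i B C} con' Aᵢ⊩⊥ ⊩¬¬A
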